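{- Let $m\ge 3$ be odd and $n=2n_1$ an even positive integer. Define $X=\{x_{i,j}\}$ on the vertices of $\mathcal{K}_{m,n}$ by \begin{itemize} \item $x_{2i-1,2j-1}=(j-1)m+i$ for $1\le i\le \lfloor (m+1)/2\rfloor$, $1\le j\le \lfloor (n_1+1)/2\rfloor$; \item $x_{2i,2j-1}=(n+1-j)m+1-\lfloor (m+1)/2\rfloor-i$ for $1\le i\le\lfloor m/2\rfloor$, $1\le j\le \lfloor (n_1+1)/2\rfloor$; \item $x_{2i-1,2j}=(n_1-j+1)m+1-i$ for $1\le i\le \lfloor (m+1)/2\rfloor$, $1\le j\le\lfloor n_1/2\rfloor$; \item $x_{2i,2j}=(n_1+j-1)m+\lfloor (m+1)/2\rfloor+i$ for $1\le i\le\lfloor m/2\rfloor$, $1\le j\le\lfloor n_1/2\rfloor$; \end{itemize} and $x_{i,j}=mn+1-x_{i,n+1-j}$ for $1\le i\le m$, $n/2+1\le j\le n$. Then $X$ is a $C_4$-face-magic Klein bottle labeling of $\mathcal{K}_{m,n}$.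
   Context: The $m\times n$ Klein bottle grid graph $\mathcal{K}_{m,n}$ has vertex set $\{(i,j):1\le i\le m,\ 1\le j\le n\}$ and edges $(i,j)(i,j+1)$ for $1\le j\le n-1$; $(i,n)(i,1)$; $(i,j)(i+1,j)$ for $1\le i\le m-1$; and $(m,j)(1,n+1-j)$ for $1\le j\le n$. Its $4$-cycle faces in the natural Klein bottle embedding are, with column indices modulo $n$, $\{(i,j),(i,j+1),(i+1,j),(i+1,j+1)\}$ for $1\le i\le m-1$, $1\le j\le n$, and $\{(m,j),(m,j+1),(1,n+1-j),(1,n-j)\}$ for $1\le j\le n$. A $C_4$-face-magic Klein bottle labeling is a bijection $(i,j)\mapsto x_{i,j}$ onto $\{1,\dots,mn\}$ such that the label sum over every such face equals a common constant. -}

module Defs where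

open import Data.Nat using (ℕ; zero; suc; _+_; _*_; _∸_; _≤_; _≡ᵇ_; _≤ᵇ_; _<ᵇ_)
open import Data.Nat.DivMod using (_/_; _%_)
open import Data.Bool using (if_then_else_)
open import Data.Product using (_×_; ∃; ∃-syntax)
open import Relation.Binary.PropositionalEquality using (_≡_)

-- Vertices of K_{m,n} are pairs (i , j) of naturals with 1 ≤ i ≤ m, 1 ≤ j ≤ n
-- (1-indexed, as in the paper).  A labeling is a function x : ℕ → ℕ → ℕ
-- (only its values on vertices matter).

-- Reduce a column index k ∈ {0,…,2n} to the representative in {1,…,n}
-- modulo n (0 ↦ n, k > n ↦ k - n).
wrap : ℕ → ℕ → ℕ
wrap n k = if k ≡ᵇ 0 then n else (if n <ᵇ k then k ∸ n else k)

IsVertex : ℕ → ℕ → ℕ → ℕ → Set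
IsVertex m n i j = (1 ≤ i × i ≤ m) × (1 ≤ j × j ≤ n)

record IsC4FaceMagicKlein (m n : ℕ) (x : ℕ → ℕ → ℕ) : Set where
  field
    range : ∀ i j → IsVertex m n i j → 1 ≤ x i j × x i j ≤ m * n
    injective : ∀ i j i′ j′ → IsVertex m n i j → IsVertex m n i′ j′ →
                x i j ≡ x i′ j′ → i ≡ i′ × j ≡ j′
    surjective : ∀ k → 1 ≤ k → k ≤ m * n →
                 ∃[ i ] ∃[ j ] (IsVertex m n i j × x i j ≡ k)
    magic : ∃[ c ]
      ( (∀ i j → 1 ≤ i → i ≤ m ∸ 1 → 1 ≤ j → j ≤ n →
           x i j + x i (wrap n (suc j)) + x (suc i) j + x (suc i) (wrap n (suc j)) ≡ c)
      × (∀ j → 1 ≤ j → j ≤ n →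
           x m j + x m (wrap n (suc j)) + x 1 (wrap n (suc n ∸ j)) + x 1 (wrap n (n ∸ j)) ≡ c) )

isOdd : ℕ → Set
isOdd k = k % 2 ≡ 1

-- The labeling X of Proposition 3.3 on the left half (1 ≤ j ≤ n₁), n = 2 n₁.
-- Rows i = 2i′-1 (odd) or 2i′ (even), columns j = 2j′-1 (odd) or 2j′ (even).
leftLabel : (m n₁ i j : ℕ) → ℕ
leftLabel m n₁ i j =
  if i % 2 ≡ᵇ 1
  then (if j % 2 ≡ᵇ 1
        then (jo ∸ 1) * m + io
        else (n₁ ∸ je + 1) * m + 1 ∸ io)
  else (if j % 2 ≡ᵇ 1
        then (2 * n₁ + 1 ∸ jo) * m + 1 ∸ h ∸ ie
        else (n₁ + je ∸ 1) * m + h + ie)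
  where
    io = (i + 1) / 2
    ie = i / 2
    jo = (j + 1) / 2
    je = j / 2
    h  = (m + 1) / 2

X : (m n₁ i j : ℕ) → ℕ
X m n₁ i j =
  if j ≤ᵇ n₁ then leftLabel m n₁ i j
  else m * (2 * n₁) + 1 ∸ leftLabel m n₁ i (2 * n₁ + 1 ∸ j)

module Submission where

-- Write N = n₁m and T = mn + 1 = 2N + 1.  Number the cells of the left half by
-- P(i, j) = β(j)·m + ρⱼ(i), where the column blocks β(j) run through 0, …, n₁ − 1 and
-- the offsets ρⱼ(i) through 1, …, m; then P is a bijection onto [1, N].  The left
-- half of X is P on odd rows and T − P on even rows, so it meets every complementary
-- pair {k, T − k} of [1, 2N] exactly once, and the mirrored right half
-- x(i, n + 1 − j) = T − x(i, j) supplies the other members: X is a bijection.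
-- Since ρⱼ(i) + ρⱼ₊₁(i) = m + 1, the sum of two horizontally adjacent left labels
-- depends only on the parity of the row, and the odd-row and even-row values add up
-- to 2T.  Mirroring carries this to the right half, while an edge crossing the mirror
-- line has sum T.  A face between rows i and i + 1 therefore has sum 2T; a face across
-- the twisted edge joins row m, read forwards, to row 1, read backwards, and since m is
-- odd both rows have the same adjacent sums, so its sum is 2T as well.

open import Defs
open import Data.Nat using (ℕ; zero; suc; _+_; _*_; _∸_; _≤_; _<_; z≤n; s≤s; _≡ᵇ_; _≤ᵇ_; _<ᵇ_)
open import Data.Nat.Properties
open import Data.Nat.DivMod
open import Data.Nat.Divisibility using (m∣m*n)
open import Data.Nat.Tactic.RingSolver using (solve-∀)
open import Data.Bool using (Bool; true; false; if_then_else_; not)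
open import Data.Product using (_×_; _,_; proj₁; proj₂; ∃-syntax; uncurry)
open import Data.Sum using (_⊎_; inj₁; inj₂)
open import Data.Empty using (⊥-elim)
open import Level using (0ℓ)
open import Relation.Nullary using (yes; no)
open import Relation.Nullary.Reflects using (ofʸ; ofⁿ)
open import Relation.Unary using (Pred)
open import Relation.Binary.PropositionalEquality

-- Intervals and bijections of ℕ

infix 4 _∈[_,_]
_∈[_,_] : ℕ → ℕ → ℕ → Set
x ∈[ a , b ] = a ≤ x × x ≤ b

record IsBijectionOn (A B : Pred ℕ 0ℓ) (f : ℕ → ℕ) : Set where
  field
    maps       : ∀ {x} → A x → B (f x)
    injective  : ∀ {x x′} → A x → A x′ → f x ≡ f x′ → x ≡ x′
    surjective : ∀ {y} → B y → ∃[ x ] A x × f x ≡ y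

record IsBijectionOn₂ (A B C : Pred ℕ 0ℓ) (f : ℕ → ℕ → ℕ) : Set where
  field
    maps       : ∀ {x y} → A x → B y → C (f x y)
    injective  : ∀ {x y x′ y′} → A x → B y → A x′ → B y′ →
                 f x y ≡ f x′ y′ → x ≡ x′ × y ≡ y′
    surjective : ∀ {z} → C z → ∃[ x ] ∃[ y ] A x × B y × f x y ≡ z

IsBijectionOn-∘ : ∀ {A B C f g} → IsBijectionOn B C g → IsBijectionOn A B f →
                  IsBijectionOn A C (λ x → g (f x))
IsBijectionOn-∘ {f = f} {g} G F = record
  { maps       = λ a → G.maps (F.maps a)
  ; injective  = λ a a′ eq → F.injective a a′ (G.injective (F.maps a) (F.maps a′) eq)
  ; surjective = λ c → let (b , b∈ , gb) = G.surjective c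
                           (a , a∈ , fa) = F.surjective b∈
                       in a , a∈ , trans (cong g fa) gb
  }
  where
  module F = IsBijectionOn F
  module G = IsBijectionOn G

reflect-isBijectionOn : ∀ m → IsBijectionOn (_∈[ 1 , m ]) (_∈[ 1 , m ]) (λ r → suc m ∸ r)
reflect-isBijectionOn m = record
  { maps       = maps
  ; injective  = λ (_ , r≤m) (_ , r′≤m) → ∸-cancelˡ-≡ (m≤n⇒m≤1+n r≤m) (m≤n⇒m≤1+n r′≤m)
  ; surjective = λ {r} r∈ → suc m ∸ r , maps r∈ , m∸[m∸n]≡n (m≤n⇒m≤1+n (proj₂ r∈))
  }
  where
  maps : ∀ {r} → r ∈[ 1 , m ] → suc m ∸ r ∈[ 1 , m ]
  maps {suc r} (_ , s≤s r<m) = m<n⇒0<n∸m (s≤s r<m) , m∸n≤m m r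

m<[1+q]*m+r : ∀ m q {r} → 1 ≤ r → m < suc q * m + r
m<[1+q]*m+r m q {r} 1≤r = ≤-trans (m<m+n m 1≤r) (+-monoˡ-≤ r (m≤m+n m (q * m)))

quotRem-injective : ∀ m {q q′ r r′} → r ∈[ 1 , m ] → r′ ∈[ 1 , m ] →
                    q * m + r ≡ q′ * m + r′ → q ≡ q′ × r ≡ r′
quotRem-injective m {zero}  {zero}   _         _          eq = refl , eq
quotRem-injective m {zero}  {suc q′} (_ , r≤m) (1≤r′ , _) eq =
  ⊥-elim (<⇒≱ (m<[1+q]*m+r m q′ 1≤r′) (subst (_≤ m) eq r≤m))
quotRem-injective m {suc q} {zero}   r∈ r′∈ eq =
  let (q′≡q , r′≡r) = quotRem-injective m r′∈ r∈ (sym eq) in sym q′≡q , sym r′≡r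
quotRem-injective m {suc q} {suc q′} {r} {r′} r∈ r′∈ eq =
  let (q≡q′ , r≡r′) = quotRem-injective m {q} {q′} r∈ r′∈ (+-cancelˡ-≡ m _ _
                        (trans (sym (+-assoc m (q * m) r)) (trans eq (+-assoc m (q′ * m) r′))))
  in cong suc q≡q′ , r≡r′

quotRem-surjective : ∀ m n {z} → z ∈[ 1 , n * m ] →
                     ∃[ q ] ∃[ r ] q < n × r ∈[ 1 , m ] × q * m + r ≡ z
quotRem-surjective zero    n {suc t} (_ , t<n*0) =
  ⊥-elim (<⇒≱ t<n*0 (≤-trans (≤-reflexive (*-zeroʳ n)) z≤n))
quotRem-surjective m@(suc _) n {suc t} (_ , t<n*m) =
  t / m , suc (t % m) , m<n*o⇒m/o<n t<n*m , (s≤s z≤n , m%n<n t m) , (begin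
    t / m * m + suc (t % m)  ≡⟨ +-suc (t / m * m) (t % m) ⟩
    suc (t / m * m + t % m)  ≡⟨ cong suc (+-comm (t / m * m) (t % m)) ⟩
    suc (t % m + t / m * m)  ≡⟨ cong suc (m≡m%n+[m/n]*n t m) ⟨
    suc t                    ∎)
  where open ≡-Reasoning

mixedRadix-isBijectionOn₂ : ∀ {A B : Pred ℕ 0ℓ} {m n} {q : ℕ → ℕ} {r : ℕ → ℕ → ℕ} →
  IsBijectionOn B (_< n) q → (∀ {y} → B y → IsBijectionOn A (_∈[ 1 , m ]) (r y)) →
  IsBijectionOn₂ A B (_∈[ 1 , n * m ]) (λ x y → q y * m + r y x)
mixedRadix-isBijectionOn₂ {A} {B} {m} {n} {q} {r} Q R = record
  { maps       = maps
  ; injective  = injective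
  ; surjective = surjective
  }
  where
  module Q = IsBijectionOn Q
  module R {y} (b : B y) = IsBijectionOn (R b)

  maps : ∀ {x y} → A x → B y → q y * m + r y x ∈[ 1 , n * m ]
  maps {x} {y} a b = let (1≤r , r≤m) = R.maps b a in
    ≤-trans 1≤r (m≤n+m (r y x) (q y * m)) , (begin
      q y * m + r y x  ≤⟨ +-monoʳ-≤ (q y * m) r≤m ⟩
      q y * m + m      ≡⟨ +-comm (q y * m) m ⟩
      suc (q y) * m    ≤⟨ *-monoˡ-≤ m (Q.maps b) ⟩
      n * m            ∎)
    where open ≤-Reasoning

  injective : ∀ {x y x′ y′} → A x → B y → A x′ → B y′ →
              q y * m + r y x ≡ q y′ * m + r y′ x′ → x ≡ x′ × y ≡ y′
  injective a b a′ b′ eq with quotRem-injective m (R.maps b a) (R.maps b′ a′) eq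
  ... | qy≡qy′ , ryx≡ry′x′ with Q.injective b b′ qy≡qy′
  ... | refl = R.injective b a a′ ryx≡ry′x′ , refl

  surjective : ∀ {z} → z ∈[ 1 , n * m ] → ∃[ x ] ∃[ y ] A x × B y × q y * m + r y x ≡ z
  surjective z∈ =
    let (qz , rz , qz<n , rz∈ , eq) = quotRem-surjective m n z∈
        (y , b , qy≡qz) = Q.surjective qz<n
        (x , a , ryx≡rz) = R.surjective b rz∈
    in x , y , a , b , trans (cong₂ (λ u v → u * m + v) qy≡qz ryx≡rz) eq

-- Complementary transversals

2*n≡n+n : ∀ n → 2 * n ≡ n + n
2*n≡n+n n = cong (n +_) (+-identityʳ n)

m≡n+o⇒m∸n≡o : ∀ {m} n {o} → m ≡ n + o → m ∸ n ≡ o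
m≡n+o⇒m∸n≡o n {o} refl = m+n∸m≡n n o

complement-∈ : ∀ {M u v} → u + v ≡ M + 1 → v ∈[ 1 , M ] → u ∈[ 1 , M ]
complement-∈ {M} {u} {v} u+v≡M+1 (1≤v , v≤M) =
  +-cancelʳ-≤ M 1 u (≤-trans (≤-reflexive (trans (+-comm 1 M) (sym u+v≡M+1))) (+-monoʳ-≤ u v≤M)) ,
  +-cancelʳ-≤ 1 u M (≤-trans (+-monoʳ-≤ u 1≤v) (≤-reflexive u+v≡M+1))

complement-bounds : ∀ {N u v} → u + v ≡ N + N + 1 → v ∈[ 1 , N ] → N < u × u ≤ N + N
complement-bounds {N} {u} {v} u+v≡T (1≤v , v≤N) =
  +-cancelʳ-≤ N (suc N) u (begin
    suc N + N  ≡⟨ +-comm 1 (N + N) ⟩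
    N + N + 1  ≡⟨ u+v≡T ⟨
    u + v      ≤⟨ +-monoʳ-≤ u v≤N ⟩
    u + N      ∎) ,
  +-cancelʳ-≤ 1 u (N + N) (≤-trans (+-monoʳ-≤ u 1≤v) (≤-reflexive u+v≡T))
  where open ≤-Reasoning

record IsComplementTransversal (A B : Pred ℕ 0ℓ) (M : ℕ) (L : ℕ → ℕ → ℕ) : Set where
  field
    range           : ∀ {x y} → A x → B y → L x y ∈[ 1 , M ]
    injective       : ∀ {x y x′ y′} → A x → B y → A x′ → B y′ →
                      L x y ≡ L x′ y′ → x ≡ x′ × y ≡ y′
    complement-free : ∀ {x y x′ y′} → A x → B y → A x′ → B y′ → L x y + L x′ y′ ≢ M + 1
    covers          : ∀ {k} → k ∈[ 1 , M ] →
                      ∃[ x ] ∃[ y ] A x × B y × (L x y ≡ k ⊎ L x y + k ≡ M + 1)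

Folds : Bool → ℕ → ℕ → ℕ → Set
Folds true  T u v = u ≡ v
Folds false T u v = u + v ≡ T

Folds-+ : ∀ b {T u v u′ v′} → Folds b T u v → Folds b T u′ v′ →
          Folds b (T + T) (u + u′) (v + v′)
Folds-+ true  u≡v u′≡v′ = cong₂ _+_ u≡v u′≡v′
Folds-+ false {T} {u} {v} {u′} {v′} u+v≡T u′+v′≡T =
  trans (interchange u u′ v v′) (cong₂ _+_ u+v≡T u′+v′≡T)
  where
  interchange : ∀ a b c d → a + b + (c + d) ≡ (a + c) + (b + d)
  interchange = solve-∀

Folds-opposite : ∀ b {T u u′ v} → Folds b T u v → Folds (not b) T u′ v → u + u′ ≡ T
Folds-opposite true  {u′ = u′} refl  u′+v≡T = trans (+-comm _ u′) u′+v≡T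
Folds-opposite false           u+v≡T refl   = u+v≡T

module SignedFolding {N : ℕ} {A B : Pred ℕ 0ℓ} {P L : ℕ → ℕ → ℕ} (s : ℕ → Bool)
  (P-bijection : IsBijectionOn₂ A B (_∈[ 1 , N ]) P)
  (folds : ∀ {x y} → A x → B y → Folds (s x) (N + N + 1) (L x y) (P x y)) where

  private
    module P = IsBijectionOn₂ P-bijection
    T = N + N + 1

    N+N<T : N + N < T
    N+N<T = ≤-reflexive (+-comm 1 (N + N))

  range : ∀ {x y} → A x → B y → L x y ∈[ 1 , N + N ]
  range {x} {y} a b with s x | folds a b
  ... | true  | L≡P   = subst (_∈[ 1 , N + N ]) (sym L≡P)
                          (proj₁ (P.maps a b) , ≤-trans (proj₂ (P.maps a b)) (m≤m+n N N))
  ... | false | L+P≡T = let (N<L , L≤N+N) = complement-bounds L+P≡T (P.maps a b)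
                        in ≤-trans (s≤s z≤n) N<L , L≤N+N

  private
    low≢high : ∀ {x y x′ y′} → A x → B y → A x′ → B y′ →
               L x y ≡ P x y → L x′ y′ + P x′ y′ ≡ T → L x y ≢ L x′ y′
    low≢high a b a′ b′ L≡P L′+P′≡T L≡L′ =
      <⇒≱ (proj₁ (complement-bounds L′+P′≡T (P.maps a′ b′)))
          (subst (_≤ N) (trans (sym L≡P) L≡L′) (proj₂ (P.maps a b)))

  injective : ∀ {x y x′ y′} → A x → B y → A x′ → B y′ →
              L x y ≡ L x′ y′ → x ≡ x′ × y ≡ y′
  injective {x} {y} {x′} {y′} a b a′ b′ L≡L′ with s x | folds a b | s x′ | folds a′ b′
  ... | true  | L≡P   | true  | L′≡P′   =
    P.injective a b a′ b′ (trans (sym L≡P) (trans L≡L′ L′≡P′))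
  ... | false | L+P≡T | false | L′+P′≡T =
    P.injective a b a′ b′ (+-cancelˡ-≡ (L x y) _ _
      (trans L+P≡T (trans (sym L′+P′≡T) (cong (_+ P x′ y′) (sym L≡L′)))))
  ... | true  | L≡P   | false | L′+P′≡T =
    ⊥-elim (low≢high a b a′ b′ L≡P L′+P′≡T L≡L′)
  ... | false | L+P≡T | true  | L′≡P′   =
    ⊥-elim (low≢high a′ b′ a b L′≡P′ L+P≡T (sym L≡L′))

  private
    low+high≢T : ∀ {x y x′ y′} → A x → B y → A x′ → B y′ → s x ≡ true → s x′ ≡ false →
                 L x y ≡ P x y → L x′ y′ + P x′ y′ ≡ T → L x y + L x′ y′ ≢ T
    low+high≢T {x} {y} {x′} {y′} a b a′ b′ sx sx′ L≡P L′+P′≡T L+L′≡T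
      with P.injective a b a′ b′ (trans (sym L≡P) (+-cancelˡ-≡ (L x′ y′) _ _
             (trans (+-comm (L x′ y′) (L x y)) (trans L+L′≡T (sym L′+P′≡T)))))
    ... | refl , _ with trans (sym sx) sx′
    ...   | ()

  complement-free : ∀ {x y x′ y′} → A x → B y → A x′ → B y′ → L x y + L x′ y′ ≢ T
  complement-free {x} {y} {x′} {y′} a b a′ b′ L+L′≡T
    with s x in sx | folds a b | s x′ in sx′ | folds a′ b′
  ... | true  | L≡P   | true  | L′≡P′   = <⇒≱ N+N<T (begin
        T                ≡⟨ L+L′≡T ⟨
        L x y + L x′ y′  ≡⟨ cong₂ _+_ L≡P L′≡P′ ⟩
        P x y + P x′ y′  ≤⟨ +-mono-≤ (proj₂ (P.maps a b)) (proj₂ (P.maps a′ b′)) ⟩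
        N + N            ∎)
    where open ≤-Reasoning
  ... | false | L+P≡T | false | L′+P′≡T = <⇒≱ (≤-reflexive (T+1≡[1+N]+[1+N] N)) (begin
        suc N + suc N    ≤⟨ +-mono-≤ (proj₁ (complement-bounds L+P≡T (P.maps a b)))
                                     (proj₁ (complement-bounds L′+P′≡T (P.maps a′ b′))) ⟩
        L x y + L x′ y′  ≡⟨ L+L′≡T ⟩
        T                ∎)
    where
    open ≤-Reasoning
    T+1≡[1+N]+[1+N] : ∀ N → suc (N + N + 1) ≡ suc N + suc N
    T+1≡[1+N]+[1+N] = solve-∀
  ... | true  | L≡P   | false | L′+P′≡T = low+high≢T a b a′ b′ sx sx′ L≡P L′+P′≡T L+L′≡T
  ... | false | L+P≡T | true  | L′≡P′   =
    low+high≢T a′ b′ a b sx′ sx L′≡P′ L+P≡T (trans (+-comm (L x′ y′) (L x y)) L+L′≡T)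

  private
    hit : ∀ {x y k} → A x → B y → P x y ≡ k → L x y ≡ k ⊎ L x y + k ≡ T
    hit {x} {y} a b P≡k with s x | folds a b
    ... | true  | L≡P   = inj₁ (trans L≡P P≡k)
    ... | false | L+P≡T = inj₂ (subst (λ v → L x y + v ≡ T) P≡k L+P≡T)

    swap : ∀ {u k} → k ≤ T → u ≡ T ∸ k ⊎ u + (T ∸ k) ≡ T → u ≡ k ⊎ u + k ≡ T
    swap k≤T (inj₁ refl) = inj₂ (m∸n+n≡m k≤T)
    swap {u} {k} k≤T (inj₂ u+[T∸k]≡T) =
      inj₁ (+-cancelʳ-≡ (T ∸ k) u k (trans u+[T∸k]≡T (sym (m+[n∸m]≡n k≤T))))

  covers : ∀ {k} → k ∈[ 1 , N + N ] → ∃[ x ] ∃[ y ] A x × B y × (L x y ≡ k ⊎ L x y + k ≡ T)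
  covers {k} (1≤k , k≤N+N) with k ≤? N
  ... | yes k≤N =
    let (x , y , a , b , P≡k) = P.surjective (1≤k , k≤N) in x , y , a , b , hit a b P≡k
  ... | no k≰N =
    let (x , y , a , b , P≡T∸k) = P.surjective (m<n⇒0<n∸m k<T , T∸k≤N)
    in x , y , a , b , swap (<⇒≤ k<T) (hit a b P≡T∸k)
    where
    k<T : k < T
    k<T = ≤-<-trans k≤N+N N+N<T
    T∸k≤N : T ∸ k ≤ N
    T∸k≤N = ≤-trans (∸-monoʳ-≤ T (≰⇒> k≰N))
                    (≤-reflexive (m≡n+o⇒m∸n≡o (suc N) (T≡[1+N]+N N)))
      where
      T≡[1+N]+N : ∀ N → N + N + 1 ≡ suc N + N
      T≡[1+N]+N = solve-∀

  isComplementTransversal : IsComplementTransversal A B (N + N) L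
  isComplementTransversal = record
    { range = range ; injective = injective ; complement-free = complement-free ; covers = covers }

-- Mirroring a transversal across the Klein bottle

+-transfer : ∀ {a b a′ b′ c} → a + b ≡ c → a′ + b′ ≡ c → b + b′ ≡ c → a + a′ ≡ c
+-transfer {a} {b} {a′} {b′} {c} a+b≡c a′+b′≡c b+b′≡c = +-cancelʳ-≡ c _ _ (begin
  a + a′ + c           ≡⟨ cong (a + a′ +_) b+b′≡c ⟨
  a + a′ + (b + b′)    ≡⟨ interchange a a′ b b′ ⟩
  (a + b) + (a′ + b′)  ≡⟨ cong₂ _+_ a+b≡c a′+b′≡c ⟩
  c + c                ∎)
  where
  open ≡-Reasoning
  interchange : ∀ a a′ b b′ → a + a′ + (b + b′) ≡ (a + b) + (a′ + b′)
  interchange = solve-∀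

0<m≤n∸1⇒m<n : ∀ {m n} → 1 ≤ m → m ≤ n ∸ 1 → m < n
0<m≤n∸1⇒m<n {n = suc n} _   m≤n = s≤s m≤n
0<m≤n∸1⇒m<n {n = zero}  1≤m m≤0 = ⊥-elim (<⇒≱ 1≤m m≤0)

wrap-id : ∀ {n k} → k ∈[ 1 , n ] → wrap n k ≡ k
wrap-id {n} {suc k} (_ , k<n) with n <ᵇ suc k | <ᵇ-reflects-< n (suc k)
... | false | _       = refl
... | true  | ofʸ n<k = ⊥-elim (<⇒≱ n<k k<n)

wrap-suc-n : ∀ n → wrap n (suc n) ≡ 1
wrap-suc-n n with n <ᵇ suc n | <ᵇ-reflects-< n (suc n)
... | true  | _          = m+n∸n≡m 1 n
... | false | ofⁿ n≮1+n  = ⊥-elim (n≮1+n ≤-refl)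

wrap-suc∈ : ∀ {n j} → j ∈[ 1 , n ] → wrap n (suc j) ∈[ 1 , n ]
wrap-suc∈ {n} {j} (1≤j , j≤n) with m≤n⇒m<n∨m≡n j≤n
... | inj₁ j<n  rewrite wrap-id (s≤s z≤n , j<n) = s≤s z≤n , j<n
... | inj₂ refl rewrite wrap-suc-n n            = ≤-refl , 1≤j

wrap-reflect : ∀ {n j} → j ∈[ 1 , n ] → wrap n (n ∸ j) ≡ suc n ∸ wrap n (suc j)
wrap-reflect {n} {j} (1≤j , j≤n) with m≤n⇒m<n∨m≡n j≤n
... | inj₁ j<n  rewrite wrap-id (s≤s z≤n , j<n) = wrap-id (m<n⇒0<n∸m j<n , m∸n≤m n j)
... | inj₂ refl rewrite wrap-suc-n n | n∸n≡0 n  = refl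

mirrorLabel : ℕ → ℕ → (ℕ → ℕ → ℕ) → ℕ → ℕ → ℕ
mirrorLabel m n₁ L i j = if j ≤ᵇ n₁ then L i j else m * (2 * n₁) + 1 ∸ L i (2 * n₁ + 1 ∸ j)

module Mirror (m n₁ : ℕ) (L : ℕ → ℕ → ℕ)
  (L-transversal : IsComplementTransversal (_∈[ 1 , m ]) (_∈[ 1 , n₁ ]) (m * (2 * n₁)) L) where

  open IsComplementTransversal L-transversal

  private
    n = 2 * n₁
    M = m * n
    T = M + 1
    x = mirrorLabel m n₁ L

    1+n∸n₁≡1+n₁ : suc n ∸ n₁ ≡ suc n₁
    1+n∸n₁≡1+n₁ = m≡n+o⇒m∸n≡o n₁ (split n₁)
      where
      split : ∀ n₁ → suc (2 * n₁) ≡ n₁ + suc n₁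
      split = solve-∀

    n∸n₁≡n₁ : n ∸ n₁ ≡ n₁
    n∸n₁≡n₁ = m≡n+o⇒m∸n≡o n₁ (2*n≡n+n n₁)

    n₁≤n : n₁ ≤ n
    n₁≤n = m≤m+n n₁ _

  x-left : ∀ {i j} → j ≤ n₁ → x i j ≡ L i j
  x-left {i} {j} j≤n₁ with j ≤ᵇ n₁ | ≤ᵇ-reflects-≤ j n₁
  ... | true  | _        = refl
  ... | false | ofⁿ j≰n₁ = ⊥-elim (j≰n₁ j≤n₁)

  x-right : ∀ {i j} → n₁ < j → x i j ≡ T ∸ L i (suc n ∸ j)
  x-right {i} {j} n₁<j with j ≤ᵇ n₁ | ≤ᵇ-reflects-≤ j n₁
  ... | false | _        = cong (λ k → T ∸ L i (k ∸ j)) (+-comm n 1)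
  ... | true  | ofʸ j≤n₁ = ⊥-elim (<⇒≱ n₁<j j≤n₁)

  mirror-left : ∀ {j} → j ∈[ 1 , n₁ ] → n₁ < suc n ∸ j × suc n ∸ j ≤ n
  mirror-left {j} (1≤j , j≤n₁) =
    subst (_≤ suc n ∸ j) 1+n∸n₁≡1+n₁ (∸-monoʳ-≤ (suc n) j≤n₁) , ∸-monoʳ-≤ (suc n) 1≤j

  mirror-right : ∀ {j} → n₁ < j → j ≤ n → suc n ∸ j ∈[ 1 , n₁ ]
  mirror-right {j} n₁<j j≤n =
    m<n⇒0<n∸m (s≤s j≤n) , subst (suc n ∸ j ≤_) n∸n₁≡n₁ (∸-monoʳ-≤ (suc n) n₁<j)

  mirror-involutive : ∀ {j} → j ≤ n → suc n ∸ (suc n ∸ j) ≡ j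
  mirror-involutive j≤n = m∸[m∸n]≡n (m≤n⇒m≤1+n j≤n)

  L≤T : ∀ {i j} → i ∈[ 1 , m ] → j ∈[ 1 , n₁ ] → L i j ≤ T
  L≤T i∈ j∈ = ≤-trans (proj₂ (range i∈ j∈)) (m≤m+n M 1)

  x+L[mirror]≡T : ∀ {i j} → i ∈[ 1 , m ] → n₁ < j → j ≤ n → x i j + L i (suc n ∸ j) ≡ T
  x+L[mirror]≡T {i} {j} i∈ n₁<j j≤n =
    trans (cong (_+ L i (suc n ∸ j)) (x-right n₁<j)) (m∸n+n≡m (L≤T i∈ (mirror-right n₁<j j≤n)))

  x+x[mirror]≡T-left : ∀ {i j} → i ∈[ 1 , m ] → j ∈[ 1 , n₁ ] → x i j + x i (suc n ∸ j) ≡ T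
  x+x[mirror]≡T-left {i} {j} i∈ j∈ = begin
    x i j + x i (suc n ∸ j)
      ≡⟨ cong₂ _+_ (x-left (proj₂ j∈)) (x-right (proj₁ (mirror-left j∈))) ⟩
    L i j + (T ∸ L i (suc n ∸ (suc n ∸ j)))
      ≡⟨ cong (λ k → L i j + (T ∸ L i k)) (mirror-involutive (≤-trans (proj₂ j∈) n₁≤n)) ⟩
    L i j + (T ∸ L i j)
      ≡⟨ m+[n∸m]≡n (L≤T i∈ j∈) ⟩
    T ∎
    where open ≡-Reasoning

  x+x[mirror]≡T : ∀ {i j} → i ∈[ 1 , m ] → j ∈[ 1 , n ] → x i j + x i (suc n ∸ j) ≡ T
  x+x[mirror]≡T {i} {j} i∈ (1≤j , j≤n) with j ≤? n₁
  ... | yes j≤n₁ = x+x[mirror]≡T-left i∈ (1≤j , j≤n₁)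
  ... | no  j≰n₁ =
    trans (+-comm (x i j) _) (subst (λ k → x i (suc n ∸ j) + x i k ≡ T) (mirror-involutive j≤n)
      (x+x[mirror]≡T-left i∈ (mirror-right (≰⇒> j≰n₁) j≤n)))

  x-range : ∀ {i j} → IsVertex m n i j → x i j ∈[ 1 , M ]
  x-range {i} {j} (i∈ , (1≤j , j≤n)) with j ≤? n₁
  ... | yes j≤n₁ = subst (_∈[ 1 , M ]) (sym (x-left j≤n₁)) (range i∈ (1≤j , j≤n₁))
  ... | no  j≰n₁ = complement-∈ (x+L[mirror]≡T i∈ (≰⇒> j≰n₁) j≤n)
                                (range i∈ (mirror-right (≰⇒> j≰n₁) j≤n))

  private
    left≢right : ∀ {i j i′ j′} → i ∈[ 1 , m ] → j ∈[ 1 , n₁ ] →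
                 i′ ∈[ 1 , m ] → n₁ < j′ → j′ ≤ n → x i j ≢ x i′ j′
    left≢right {i} {j} {i′} {j′} i∈ j∈ i′∈ n₁<j′ j′≤n x≡x′ =
      complement-free i∈ j∈ i′∈ (mirror-right n₁<j′ j′≤n)
        (trans (cong (_+ L i′ (suc n ∸ j′)) (trans (sym (x-left (proj₂ j∈))) x≡x′))
               (x+L[mirror]≡T i′∈ n₁<j′ j′≤n))

    right-injective : ∀ {i j i′ j′} → i ∈[ 1 , m ] → n₁ < j → j ≤ n →
                      i′ ∈[ 1 , m ] → n₁ < j′ → j′ ≤ n →
                      x i j ≡ x i′ j′ → i ≡ i′ × j ≡ j′
    right-injective {i} {j} {i′} {j′} i∈ n₁<j j≤n i′∈ n₁<j′ j′≤n x≡x′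
      with injective i∈ (mirror-right n₁<j j≤n) i′∈ (mirror-right n₁<j′ j′≤n)
             (+-cancelˡ-≡ (x i j) _ _ (begin
               x i j + L i (suc n ∸ j)      ≡⟨ x+L[mirror]≡T i∈ n₁<j j≤n ⟩
               T                            ≡⟨ x+L[mirror]≡T i′∈ n₁<j′ j′≤n ⟨
               x i′ j′ + L i′ (suc n ∸ j′)  ≡⟨ cong (_+ L i′ (suc n ∸ j′)) x≡x′ ⟨
               x i j + L i′ (suc n ∸ j′)    ∎))
      where open ≡-Reasoning
    ... | refl , mirror≡ = refl , ∸-cancelˡ-≡ (m≤n⇒m≤1+n j≤n) (m≤n⇒m≤1+n j′≤n) mirror≡

  x-injective : ∀ {i j i′ j′} → IsVertex m n i j → IsVertex m n i′ j′ →
                x i j ≡ x i′ j′ → i ≡ i′ × j ≡ j′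
  x-injective (i∈ , (1≤j , j≤n)) (i′∈ , (1≤j′ , j′≤n)) x≡x′ with _ ≤? n₁ | _ ≤? n₁
  ... | yes j≤n₁ | yes j′≤n₁ = injective i∈ (1≤j , j≤n₁) i′∈ (1≤j′ , j′≤n₁)
                                 (trans (sym (x-left j≤n₁)) (trans x≡x′ (x-left j′≤n₁)))
  ... | no  j≰n₁ | no  j′≰n₁ =
    right-injective i∈ (≰⇒> j≰n₁) j≤n i′∈ (≰⇒> j′≰n₁) j′≤n x≡x′
  ... | yes j≤n₁ | no  j′≰n₁ =
    ⊥-elim (left≢right i∈ (1≤j , j≤n₁) i′∈ (≰⇒> j′≰n₁) j′≤n x≡x′)
  ... | no  j≰n₁ | yes j′≤n₁ =
    ⊥-elim (left≢right i′∈ (1≤j′ , j′≤n₁) i∈ (≰⇒> j≰n₁) j≤n (sym x≡x′))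

  x-surjective : ∀ {k} → k ∈[ 1 , M ] → ∃[ i ] ∃[ j ] IsVertex m n i j × x i j ≡ k
  x-surjective k∈ with covers k∈
  ... | i , j , i∈ , (1≤j , j≤n₁) , inj₁ L≡k =
    i , j , (i∈ , (1≤j , ≤-trans j≤n₁ n₁≤n)) , trans (x-left j≤n₁) L≡k
  ... | i , j , i∈ , j∈ , inj₂ L+k≡T =
    i , suc n ∸ j , (i∈ , (≤-trans (s≤s z≤n) n₁<j′ , j′≤n)) ,
    +-cancelʳ-≡ (L i j) _ _ (trans x+L≡T (trans (sym L+k≡T) (+-comm (L i j) _)))
    where
    n₁<j′ = proj₁ (mirror-left j∈)
    j′≤n  = proj₂ (mirror-left j∈)
    x+L≡T : x i (suc n ∸ j) + L i j ≡ T
    x+L≡T = subst (λ k → x i (suc n ∸ j) + L i k ≡ T)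
                  (mirror-involutive (≤-trans (proj₂ j∈) n₁≤n)) (x+L[mirror]≡T i∈ n₁<j′ j′≤n)

  pairSum : ℕ → ℕ → ℕ
  pairSum i j = x i j + x i (wrap n (suc j))

  pairSum-left : ∀ {i j} → suc j ≤ n₁ → pairSum i j ≡ L i j + L i (suc j)
  pairSum-left {i} {j} 1+j≤n₁ =
    cong₂ _+_ (x-left (<⇒≤ 1+j≤n₁))
              (trans (cong (x i) (wrap-id (s≤s z≤n , ≤-trans 1+j≤n₁ n₁≤n))) (x-left 1+j≤n₁))

  pairSum-across : ∀ {i j} → i ∈[ 1 , m ] → j ∈[ 1 , n ] → wrap n (suc j) ≡ suc n ∸ j →
                   pairSum i j ≡ T
  pairSum-across {i} {j} i∈ j∈ eq = trans (cong (λ k → x i j + x i k) eq) (x+x[mirror]≡T i∈ j∈)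

  pairSum-middle : ∀ {i} → i ∈[ 1 , m ] → 1 ≤ n₁ → pairSum i n₁ ≡ T
  pairSum-middle i∈ 1≤n₁ =
    pairSum-across i∈ (1≤n₁ , n₁≤n) (trans (wrap-id (s≤s z≤n , 1+n₁≤n)) (sym 1+n∸n₁≡1+n₁))
    where
    1+n₁≤n : suc n₁ ≤ n
    1+n₁≤n = subst₂ _≤_ (+-comm n₁ 1) (sym (2*n≡n+n n₁)) (+-monoʳ-≤ n₁ 1≤n₁)

  pairSum-end : ∀ {i} → i ∈[ 1 , m ] → 1 ≤ n → pairSum i n ≡ T
  pairSum-end i∈ 1≤n = pairSum-across i∈ (1≤n , ≤-refl) (trans (wrap-suc-n n) (sym (m+n∸n≡m 1 n)))

  pairSum-reflected : ∀ {i j} → i ∈[ 1 , m ] → n₁ < j → suc j ≤ n →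
                      pairSum i j + pairSum i (n ∸ j) ≡ T + T
  pairSum-reflected {i} {j} i∈ n₁<j 1+j≤n = begin
    pairSum i j + pairSum i (n ∸ j)
      ≡⟨ cong₂ (λ a b → x i j + x i a + (x i (n ∸ j) + x i b))
               (wrap-id (s≤s z≤n , 1+j≤n))
               (trans (cong (wrap n) (sym (+-∸-assoc 1 j≤n)))
                      (wrap-id (m<n⇒0<n∸m (s≤s j≤n) , ∸-monoʳ-≤ (suc n) 1≤j))) ⟩
    x i j + x i (suc j) + (x i (suc n ∸ suc j) + x i (suc n ∸ j))
      ≡⟨ interchange (x i j) (x i (suc j)) _ _ ⟩
    (x i j + x i (suc n ∸ j)) + (x i (suc j) + x i (suc n ∸ suc j))
      ≡⟨ cong₂ _+_ (x+x[mirror]≡T i∈ (1≤j , j≤n)) (x+x[mirror]≡T i∈ (s≤s z≤n , 1+j≤n)) ⟩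
    T + T ∎
    where
    open ≡-Reasoning
    1≤j : 1 ≤ j
    1≤j = ≤-trans (s≤s z≤n) n₁<j
    j≤n : j ≤ n
    j≤n = <⇒≤ 1+j≤n
    interchange : ∀ a b c d → a + b + (c + d) ≡ (a + d) + (b + c)
    interchange = solve-∀

  reflected-inLeft : ∀ {j} → n₁ < j → suc j ≤ n → 1 ≤ n ∸ j × suc (n ∸ j) ≤ n₁
  reflected-inLeft {j} n₁<j 1+j≤n =
    m<n⇒0<n∸m 1+j≤n ,
    subst (_≤ n₁) (+-∸-assoc 1 (<⇒≤ 1+j≤n)) (proj₂ (mirror-right n₁<j (<⇒≤ 1+j≤n)))

  data ColumnCase : ℕ → Set where
    inLeft   : ∀ {j} → 1 ≤ j → suc j ≤ n₁ → ColumnCase j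
    atMiddle : 1 ≤ n₁ → ColumnCase n₁
    inRight  : ∀ {j} → n₁ < j → suc j ≤ n → ColumnCase j
    atEnd    : 1 ≤ n → ColumnCase n

  columnCase : ∀ {j} → j ∈[ 1 , n ] → ColumnCase j
  columnCase {j} (1≤j , j≤n) with j ≤? n₁
  ... | yes j≤n₁ with m≤n⇒m<n∨m≡n j≤n₁
  ...   | inj₁ j<n₁ = inLeft 1≤j j<n₁
  ...   | inj₂ refl = atMiddle 1≤j
  columnCase {j} (1≤j , j≤n) | no j≰n₁ with m≤n⇒m<n∨m≡n j≤n
  ...   | inj₁ j<n  = inRight (≰⇒> j≰n₁) j<n
  ...   | inj₂ refl = atEnd 1≤j

  ConsecutiveRowsMagic : Set
  ConsecutiveRowsMagic = ∀ {i j} → 1 ≤ i → suc i ≤ m → 1 ≤ j → suc j ≤ n₁ →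
    (L i j + L i (suc j)) + (L (suc i) j + L (suc i) (suc j)) ≡ T + T

  TwistCompatible : Set
  TwistCompatible = ∀ {j} → 1 ≤ j → suc j ≤ n₁ → L m j + L m (suc j) ≡ L 1 j + L 1 (suc j)

  pairSum-consecutiveRows : ConsecutiveRowsMagic → ∀ {i j} → 1 ≤ i → suc i ≤ m → j ∈[ 1 , n ] →
                            pairSum i j + pairSum (suc i) j ≡ T + T
  pairSum-consecutiveRows rows-magic {i} 1≤i 1+i≤m j∈ = byColumn (columnCase j∈)
    where
    i∈ : i ∈[ 1 , m ]
    i∈ = 1≤i , <⇒≤ 1+i≤m
    1+i∈ : suc i ∈[ 1 , m ]
    1+i∈ = s≤s z≤n , 1+i≤m
    left : ∀ {j} → 1 ≤ j → suc j ≤ n₁ → pairSum i j + pairSum (suc i) j ≡ T + T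
    left 1≤j 1+j≤n₁ =
      trans (cong₂ _+_ (pairSum-left 1+j≤n₁) (pairSum-left 1+j≤n₁))
            (rows-magic 1≤i 1+i≤m 1≤j 1+j≤n₁)
    byColumn : ∀ {j} → ColumnCase j → pairSum i j + pairSum (suc i) j ≡ T + T
    byColumn (inLeft 1≤j 1+j≤n₁)      = left 1≤j 1+j≤n₁
    byColumn (atMiddle 1≤n₁)          = cong₂ _+_ (pairSum-middle i∈ 1≤n₁) (pairSum-middle 1+i∈ 1≤n₁)
    byColumn (atEnd 1≤n)              = cong₂ _+_ (pairSum-end i∈ 1≤n) (pairSum-end 1+i∈ 1≤n)
    byColumn {j} (inRight n₁<j 1+j≤n) =
      +-transfer {pairSum i j} {pairSum i (n ∸ j)} {pairSum (suc i) j}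
        (pairSum-reflected i∈ n₁<j 1+j≤n) (pairSum-reflected 1+i∈ n₁<j 1+j≤n)
        (uncurry left (reflected-inLeft n₁<j 1+j≤n))

  module _ (1≤m : 1 ≤ m) (twist : TwistCompatible) where

    private
      1∈ : 1 ∈[ 1 , m ]
      1∈ = ≤-refl , 1≤m
      m∈ : m ∈[ 1 , m ]
      m∈ = 1≤m , ≤-refl

    pairSum-twist : ∀ {j} → j ∈[ 1 , n ] → pairSum m j ≡ pairSum 1 j
    pairSum-twist j∈ = byColumn (columnCase j∈)
      where
      left : ∀ {j} → 1 ≤ j → suc j ≤ n₁ → pairSum m j ≡ pairSum 1 j
      left 1≤j 1+j≤n₁ =
        trans (pairSum-left 1+j≤n₁) (trans (twist 1≤j 1+j≤n₁) (sym (pairSum-left 1+j≤n₁)))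
      byColumn : ∀ {j} → ColumnCase j → pairSum m j ≡ pairSum 1 j
      byColumn (inLeft 1≤j 1+j≤n₁)      = left 1≤j 1+j≤n₁
      byColumn (atMiddle 1≤n₁)          = trans (pairSum-middle m∈ 1≤n₁) (sym (pairSum-middle 1∈ 1≤n₁))
      byColumn (atEnd 1≤n)              = trans (pairSum-end m∈ 1≤n) (sym (pairSum-end 1∈ 1≤n))
      byColumn {j} (inRight n₁<j 1+j≤n) = +-cancelʳ-≡ (pairSum m (n ∸ j)) _ _ (begin
        pairSum m j + pairSum m (n ∸ j)  ≡⟨ pairSum-reflected m∈ n₁<j 1+j≤n ⟩
        T + T                            ≡⟨ pairSum-reflected 1∈ n₁<j 1+j≤n ⟨
        pairSum 1 j + pairSum 1 (n ∸ j)  ≡⟨ cong (pairSum 1 j +_) reflected ⟨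
        pairSum 1 j + pairSum m (n ∸ j)  ∎)
        where
        open ≡-Reasoning
        reflected = uncurry left (reflected-inLeft n₁<j 1+j≤n)

    kleinFace : ∀ {j} → j ∈[ 1 , n ] →
      x m j + x m (wrap n (suc j)) + x 1 (wrap n (suc n ∸ j)) + x 1 (wrap n (n ∸ j)) ≡ T + T
    kleinFace {j} j∈@(1≤j , j≤n) = begin
      x m j + x m j⁺ + x 1 (wrap n (suc n ∸ j)) + x 1 (wrap n (n ∸ j))
        ≡⟨ cong₂ (λ a b → pairSum m j + x 1 a + x 1 b)
                 (wrap-id (m<n⇒0<n∸m (s≤s j≤n) , ∸-monoʳ-≤ (suc n) 1≤j)) (wrap-reflect j∈) ⟩
      pairSum m j + x 1 (suc n ∸ j) + x 1 (suc n ∸ j⁺)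
        ≡⟨ cong (λ s → s + x 1 (suc n ∸ j) + x 1 (suc n ∸ j⁺)) (pairSum-twist j∈) ⟩
      x 1 j + x 1 j⁺ + x 1 (suc n ∸ j) + x 1 (suc n ∸ j⁺)
        ≡⟨ regroup (x 1 j) (x 1 j⁺) _ _ ⟩
      (x 1 j + x 1 (suc n ∸ j)) + (x 1 j⁺ + x 1 (suc n ∸ j⁺))
        ≡⟨ cong₂ _+_ (x+x[mirror]≡T 1∈ j∈) (x+x[mirror]≡T 1∈ (wrap-suc∈ j∈)) ⟩
      T + T ∎
      where
      open ≡-Reasoning
      j⁺ = wrap n (suc j)
      regroup : ∀ a b c d → a + b + c + d ≡ (a + c) + (b + d)
      regroup = solve-∀

  isC4FaceMagicKlein : 1 ≤ m → ConsecutiveRowsMagic → TwistCompatible → IsC4FaceMagicKlein m n x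
  isC4FaceMagicKlein 1≤m rows-magic twist = record
    { range      = λ _ _ v → x-range v
    ; injective  = λ _ _ _ _ v v′ → x-injective v v′
    ; surjective = λ _ 1≤k k≤M → x-surjective (1≤k , k≤M)
    ; magic      = T + T , interiorFace , (λ _ 1≤j j≤n → kleinFace 1≤m twist (1≤j , j≤n))
    }
    where
    interiorFace : ∀ i j → 1 ≤ i → i ≤ m ∸ 1 → 1 ≤ j → j ≤ n →
      x i j + x i (wrap n (suc j)) + x (suc i) j + x (suc i) (wrap n (suc j)) ≡ T + T
    interiorFace i j 1≤i i≤m∸1 1≤j j≤n =
      trans (+-assoc (pairSum i j) (x (suc i) j) (x (suc i) (wrap n (suc j))))
            (pairSum-consecutiveRows rows-magic 1≤i (0<m≤n∸1⇒m<n 1≤i i≤m∸1) (1≤j , j≤n))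

-- Parity and halving

isOddᵇ : ℕ → Bool
isOddᵇ k = k % 2 ≡ᵇ 1

data ParityView : ℕ → Set where
  even : ∀ k → ParityView (2 * k)
  odd  : ∀ k → ParityView (suc (2 * k))

parityView : ∀ n → ParityView n
parityView zero = even 0
parityView (suc n) with parityView n
... | even k = odd k
... | odd k  = subst ParityView (*-suc 2 k) (even (suc k))

isOddᵇ[2*n]≡false : ∀ n → isOddᵇ (2 * n) ≡ false
isOddᵇ[2*n]≡false n = cong (_≡ᵇ 1) (trans (cong (_% 2) (*-comm 2 n)) (m*n%n≡0 n 2))

isOddᵇ[1+2*n]≡true : ∀ n → isOddᵇ (suc (2 * n)) ≡ true
isOddᵇ[1+2*n]≡true n =
  cong (_≡ᵇ 1) (trans (cong (λ k → suc k % 2) (*-comm 2 n)) ([m+kn]%n≡m%n 1 n 2))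

isOddᵇ-suc : ∀ n → isOddᵇ (suc n) ≡ not (isOddᵇ n)
isOddᵇ-suc n with parityView n
... | even k = trans (isOddᵇ[1+2*n]≡true k) (cong not (sym (isOddᵇ[2*n]≡false k)))
... | odd k  = trans (cong isOddᵇ (sym (*-suc 2 k)))
                     (trans (isOddᵇ[2*n]≡false (suc k)) (cong not (sym (isOddᵇ[1+2*n]≡true k))))

2*n/2≡n : ∀ n → 2 * n / 2 ≡ n
2*n/2≡n n = trans (cong (_/ 2) (*-comm 2 n)) (m*n/n≡m n 2)

[1+2*n]/2≡n : ∀ n → suc (2 * n) / 2 ≡ n
[1+2*n]/2≡n n = trans (+-distrib-/-∣ʳ 1 {d = 2} (m∣m*n n)) (2*n/2≡n n)

[1+2*n+1]/2≡1+n : ∀ n → (suc (2 * n) + 1) / 2 ≡ suc n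
[1+2*n+1]/2≡1+n n = trans (cong (_/ 2) (1+2*n+1≡2*[1+n] n)) (2*n/2≡n (suc n))
  where
  1+2*n+1≡2*[1+n] : ∀ n → suc (2 * n) + 1 ≡ 2 * suc n
  1+2*n+1≡2*[1+n] = solve-∀

[n+1]/2+n/2≡n : ∀ n → (n + 1) / 2 + n / 2 ≡ n
[n+1]/2+n/2≡n n with parityView n
... | even k rewrite +-comm (2 * k) 1 | [1+2*n]/2≡n k | 2*n/2≡n k = cong (k +_) (sym (+-identityʳ k))
... | odd k  rewrite [1+2*n+1]/2≡1+n k | [1+2*n]/2≡n k = cong (λ t → suc (k + t)) (sym (+-identityʳ k))

2*m≤n⇒m≤n/2 : ∀ {m n} → 2 * m ≤ n → m ≤ n / 2
2*m≤n⇒m≤n/2 {m} le = subst (_≤ _) (2*n/2≡n m) (/-monoˡ-≤ 2 le)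

m≤n/2⇒2*m≤n : ∀ {m n} → m ≤ n / 2 → 2 * m ≤ n
m≤n/2⇒2*m≤n {m} {n} le = ≤-trans (*-monoʳ-≤ 2 le) (subst (_≤ n) (*-comm (n / 2) 2) (m/n*n≤m n 2))

-- The left half of X

-- rowRank and colBlock use the same halvings as leftLabel, so that leftLabel-folds
-- becomes arithmetic once the parities of the row and the column are fixed.
rowRank : ℕ → ℕ → ℕ
rowRank m i = if isOddᵇ i then (i + 1) / 2 else (m + 1) / 2 + i / 2

colBlock : ℕ → ℕ → ℕ
colBlock n₁ j = if isOddᵇ j then (j + 1) / 2 ∸ 1 else n₁ ∸ j / 2

rowRank-odd : ∀ m a → rowRank m (suc (2 * a)) ≡ suc a
rowRank-odd m a rewrite isOddᵇ[1+2*n]≡true a = [1+2*n+1]/2≡1+n a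

rowRank-even : ∀ m b → rowRank m (2 * b) ≡ (m + 1) / 2 + b
rowRank-even m b rewrite isOddᵇ[2*n]≡false b = cong ((m + 1) / 2 +_) (2*n/2≡n b)

module _ (m : ℕ) where

  private
    h = (m + 1) / 2

    h+m/2≡m : h + m / 2 ≡ m
    h+m/2≡m = [n+1]/2+n/2≡n m

    h≤m : h ≤ m
    h≤m = subst (h ≤_) h+m/2≡m (m≤m+n h (m / 2))

    oddRow⇒rank≤h : ∀ {a} → suc (2 * a) ≤ m → suc a ≤ h
    oddRow⇒rank≤h {a} le = 2*m≤n⇒m≤n/2 (subst₂ _≤_ (sym (*-suc 2 a)) (+-comm 1 m) (s≤s le))

    rank≤h⇒oddRow : ∀ {a} → suc a ≤ h → suc (2 * a) ≤ m
    rank≤h⇒oddRow {a} le = ≤-pred (subst₂ _≤_ (*-suc 2 a) (+-comm m 1) (m≤n/2⇒2*m≤n le))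

    evenRow⇒rank≤m : ∀ {b} → 2 * b ≤ m → h + b ≤ m
    evenRow⇒rank≤m le = subst (h + _ ≤_) h+m/2≡m (+-monoʳ-≤ h (2*m≤n⇒m≤n/2 le))

    rank≤m⇒evenRow : ∀ {b} → h + b ≤ m → 2 * b ≤ m
    rank≤m⇒evenRow le = m≤n/2⇒2*m≤n (+-cancelˡ-≤ h _ _ (subst (h + _ ≤_) (sym h+m/2≡m) le))

    oddRank<evenRank : ∀ {a b} → suc (2 * a) ≤ m → rowRank m (suc (2 * a)) < rowRank m (2 * suc b)
    oddRank<evenRank {a} {b} le rewrite rowRank-odd m a | rowRank-even m (suc b) | +-suc h b =
      s≤s (≤-trans (oddRow⇒rank≤h le) (m≤m+n h b))

    maps : ∀ {i} → i ∈[ 1 , m ] → rowRank m i ∈[ 1 , m ]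
    maps {i} (1≤i , i≤m) with parityView i
    ... | odd a        rewrite rowRank-odd m a        =
      s≤s z≤n , ≤-trans (oddRow⇒rank≤h i≤m) h≤m
    ... | even (suc b) rewrite rowRank-even m (suc b) =
      ≤-trans (s≤s z≤n) (m≤n+m (suc b) h) , evenRow⇒rank≤m i≤m

    injective : ∀ {i i′} → i ∈[ 1 , m ] → i′ ∈[ 1 , m ] → rowRank m i ≡ rowRank m i′ → i ≡ i′
    injective {i} {i′} (_ , i≤m) (_ , i′≤m) eq with parityView i | parityView i′
    ... | odd a | odd a′ = cong (λ k → suc (2 * k))
      (suc-injective (trans (sym (rowRank-odd m a)) (trans eq (rowRank-odd m a′))))
    ... | even b | even b′ = cong (2 *_)
      (+-cancelˡ-≡ h _ _ (trans (sym (rowRank-even m b)) (trans eq (rowRank-even m b′))))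
    ... | odd a        | even (suc b′) = ⊥-elim (<-irrefl eq (oddRank<evenRank {a} {b′} i≤m))
    ... | even (suc b) | odd a′        = ⊥-elim (<-irrefl (sym eq) (oddRank<evenRank {a′} {b} i′≤m))

    surjective : ∀ {r} → r ∈[ 1 , m ] → ∃[ i ] i ∈[ 1 , m ] × rowRank m i ≡ r
    surjective {suc a} (_ , r≤m) with suc a ≤? h
    ... | yes r≤h = suc (2 * a) , (s≤s z≤n , rank≤h⇒oddRow r≤h) , rowRank-odd m a
    ... | no  r≰h =
      2 * b , (≤-trans 1≤b (m≤m+n b _) , rank≤m⇒evenRow (subst (_≤ m) (sym h+b≡r) r≤m)) ,
      trans (rowRank-even m b) h+b≡r
      where
      b = suc a ∸ h
      1≤b : 1 ≤ b
      1≤b = m<n⇒0<n∸m (≰⇒> r≰h)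
      h+b≡r : h + b ≡ suc a
      h+b≡r = m+[n∸m]≡n (<⇒≤ (≰⇒> r≰h))

  rowRank-isBijectionOn : IsBijectionOn (_∈[ 1 , m ]) (_∈[ 1 , m ]) (rowRank m)
  rowRank-isBijectionOn = record { maps = maps ; injective = injective ; surjective = surjective }

colBlock-odd : ∀ n₁ c → colBlock n₁ (suc (2 * c)) ≡ c
colBlock-odd n₁ c rewrite isOddᵇ[1+2*n]≡true c = cong (_∸ 1) ([1+2*n+1]/2≡1+n c)

colBlock-even : ∀ n₁ c → colBlock n₁ (2 * c) ≡ n₁ ∸ c
colBlock-even n₁ c rewrite isOddᵇ[2*n]≡false c = cong (n₁ ∸_) (2*n/2≡n c)

oddBlock≢evenBlock : ∀ {n c c′} → suc (2 * c) ≤ n → 2 * suc c′ ≤ n → c ≢ n ∸ suc c′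
oddBlock≢evenBlock {n} {c} {c′} odd≤n even≤n c≡n∸1+c′
  with m≤n⇒∃[o]m+o≡n (≤-trans (m≤m+n (suc c′) _) even≤n)
... | o , refl rewrite m+n∸m≡n (suc c′) o | c≡n∸1+c′ =
  <-irrefl refl (≤-trans (≤-reflexive (regroup c′ o)) (+-mono-≤ odd≤n even≤n))
  where
  regroup : ∀ c′ o → suc (suc c′ + o + (suc c′ + o)) ≡ suc (2 * o) + 2 * suc c′
  regroup = solve-∀

module _ (n₁ : ℕ) where

  private
    maps : ∀ {j} → j ∈[ 1 , n₁ ] → colBlock n₁ j < n₁
    maps {j} (_ , j≤n₁) with parityView j
    ... | odd c        rewrite colBlock-odd n₁ c        = ≤-trans (s≤s (m≤m+n c _)) j≤n₁
    ... | even (suc c) rewrite colBlock-even n₁ (suc c) =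
      ∸-monoʳ-< (s≤s z≤n) (≤-trans (m≤m+n (suc c) _) j≤n₁)

    injective : ∀ {j j′} → j ∈[ 1 , n₁ ] → j′ ∈[ 1 , n₁ ] →
                colBlock n₁ j ≡ colBlock n₁ j′ → j ≡ j′
    injective {j} {j′} (_ , j≤n₁) (_ , j′≤n₁) eq with parityView j | parityView j′
    ... | odd c | odd c′ = cong (λ k → suc (2 * k))
      (trans (sym (colBlock-odd n₁ c)) (trans eq (colBlock-odd n₁ c′)))
    ... | even c | even c′ = cong (2 *_)
      (∸-cancelˡ-≡ (≤-trans (m≤m+n c _) j≤n₁) (≤-trans (m≤m+n c′ _) j′≤n₁)
        (trans (sym (colBlock-even n₁ c)) (trans eq (colBlock-even n₁ c′))))
    ... | odd c | even (suc c′) = ⊥-elim (oddBlock≢evenBlock j≤n₁ j′≤n₁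
      (trans (sym (colBlock-odd n₁ c)) (trans eq (colBlock-even n₁ (suc c′)))))
    ... | even (suc c) | odd c′ = ⊥-elim (oddBlock≢evenBlock j′≤n₁ j≤n₁
      (trans (sym (colBlock-odd n₁ c′)) (trans (sym eq) (colBlock-even n₁ (suc c)))))

    surjective : ∀ {t} → t < n₁ → ∃[ j ] j ∈[ 1 , n₁ ] × colBlock n₁ j ≡ t
    surjective {t} t<n₁ with suc (2 * t) ≤? n₁
    ... | yes odd≤n₁ = suc (2 * t) , (s≤s z≤n , odd≤n₁) , colBlock-odd n₁ t
    ... | no  odd≰n₁ =
      2 * d , (≤-trans 1≤d (m≤m+n d _) , 2d≤n₁) ,
      trans (colBlock-even n₁ d) (m∸[m∸n]≡n (<⇒≤ t<n₁))
      where
      d = n₁ ∸ t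
      1≤d : 1 ≤ d
      1≤d = m<n⇒0<n∸m t<n₁
      d≤t : d ≤ t
      d≤t = subst (d ≤_) (m+n∸m≡n t t)
                  (∸-monoˡ-≤ t (subst (n₁ ≤_) (2*n≡n+n t) (≤-pred (≰⇒> odd≰n₁))))
      2d≤n₁ : 2 * d ≤ n₁
      2d≤n₁ = subst₂ _≤_ (sym (2*n≡n+n d)) (m∸n+n≡m (<⇒≤ t<n₁)) (+-monoʳ-≤ d d≤t)

  colBlock-isBijectionOn : IsBijectionOn (_∈[ 1 , n₁ ]) (_< n₁) (colBlock n₁)
  colBlock-isBijectionOn = record { maps = maps ; injective = injective ; surjective = surjective }

colOffset : ℕ → Bool → ℕ → ℕ
colOffset m oddCol i = if oddCol then rowRank m i else suc m ∸ rowRank m i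

colOffset-isBijectionOn : ∀ m b → IsBijectionOn (_∈[ 1 , m ]) (_∈[ 1 , m ]) (colOffset m b)
colOffset-isBijectionOn m true  = rowRank-isBijectionOn m
colOffset-isBijectionOn m false = IsBijectionOn-∘ (reflect-isBijectionOn m) (rowRank-isBijectionOn m)

rowRank≤m : ∀ m {i} → i ∈[ 1 , m ] → rowRank m i ≤ m
rowRank≤m m i∈ = proj₂ (IsBijectionOn.maps (rowRank-isBijectionOn m) i∈)

colOffset+colOffset[not] : ∀ {m i} b → i ∈[ 1 , m ] →
                           colOffset m b i + colOffset m (not b) i ≡ suc m
colOffset+colOffset[not] {m} true  i∈ = m+[n∸m]≡n (m≤n⇒m≤1+n (rowRank≤m m i∈))
colOffset+colOffset[not] {m} false i∈ = m∸n+n≡m (m≤n⇒m≤1+n (rowRank≤m m i∈))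

foldedLabel : ℕ → ℕ → ℕ → ℕ → ℕ
foldedLabel m n₁ i j = colBlock n₁ j * m + colOffset m (isOddᵇ j) i

foldedLabel-isBijectionOn₂ : ∀ m n₁ →
  IsBijectionOn₂ (_∈[ 1 , m ]) (_∈[ 1 , n₁ ]) (_∈[ 1 , n₁ * m ]) (foldedLabel m n₁)
foldedLabel-isBijectionOn₂ m n₁ =
  mixedRadix-isBijectionOn₂ (colBlock-isBijectionOn n₁) (λ {j} _ → colOffset-isBijectionOn m (isOddᵇ j))

foldedLabel-adjacent : ∀ {m n₁ i} j → i ∈[ 1 , m ] →
  foldedLabel m n₁ i j + foldedLabel m n₁ i (suc j) ≡ (colBlock n₁ j + colBlock n₁ (suc j)) * m + suc m
foldedLabel-adjacent {m} {n₁} {i} j i∈ = begin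
  foldedLabel m n₁ i j + foldedLabel m n₁ i (suc j)
    ≡⟨ regroup (colBlock n₁ j) (colBlock n₁ (suc j)) m (offset (isOddᵇ j)) (offset (isOddᵇ (suc j))) ⟩
  blocks + (offset (isOddᵇ j) + offset (isOddᵇ (suc j)))
    ≡⟨ cong (λ b → blocks + (offset (isOddᵇ j) + offset b)) (isOddᵇ-suc j) ⟩
  blocks + (offset (isOddᵇ j) + offset (not (isOddᵇ j)))
    ≡⟨ cong (blocks +_) (colOffset+colOffset[not] (isOddᵇ j) i∈) ⟩
  blocks + suc m ∎
  where
  open ≡-Reasoning
  blocks = (colBlock n₁ j + colBlock n₁ (suc j)) * m
  offset : Bool → ℕ
  offset b = colOffset m b i
  regroup : ∀ q q′ m r r′ → (q * m + r) + (q′ * m + r′) ≡ (q + q′) * m + (r + r′)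
  regroup = solve-∀

[d+1]*m+1∸r≡d*m+[1+m∸r] : ∀ d m {r} → r ≤ suc m → (d + 1) * m + 1 ∸ r ≡ d * m + (suc m ∸ r)
[d+1]*m+1∸r≡d*m+[1+m∸r] d m {r} r≤1+m =
  trans (cong (_∸ r) (regroup d m)) (+-∸-assoc (d * m) r≤1+m)
  where
  regroup : ∀ d m → (d + 1) * m + 1 ≡ d * m + suc m
  regroup = solve-∀

evenRow-oddCol-sum : ∀ {n₁ m u s} → 1 ≤ u → u ∸ 1 < n₁ → s ≤ m →
  (2 * n₁ + 1 ∸ u) * m + 1 ∸ s + ((u ∸ 1) * m + s) ≡ m * (2 * n₁) + 1
evenRow-oddCol-sum {u = suc q} {s} _ q<n₁ s≤m
  with m≤n⇒∃[o]m+o≡n q<n₁ | m≤n⇒∃[o]m+o≡n s≤m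
... | d , refl | e , refl = begin
  (2 * (suc q + d) + 1 ∸ suc q) * (s + e) + 1 ∸ s + (q * (s + e) + s)
    ≡⟨ cong (λ a → a * (s + e) + 1 ∸ s + (q * (s + e) + s))
            (m≡n+o⇒m∸n≡o (suc q) (split₁ q d)) ⟩
  (q + 2 * d + 2) * (s + e) + 1 ∸ s + (q * (s + e) + s)
    ≡⟨ cong (_+ (q * (s + e) + s)) (m≡n+o⇒m∸n≡o s (split₂ q d s e)) ⟩
  (q + 2 * d + 1) * s + (q + 2 * d + 2) * e + 1 + (q * (s + e) + s)
    ≡⟨ regroup q d s e ⟩
  (s + e) * (2 * (suc q + d)) + 1 ∎
  where
  open ≡-Reasoning
  split₁ : ∀ q d → 2 * (suc q + d) + 1 ≡ suc q + (q + 2 * d + 2)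
  split₁ = solve-∀
  split₂ : ∀ q d s e → (q + 2 * d + 2) * (s + e) + 1 ≡
                       s + ((q + 2 * d + 1) * s + (q + 2 * d + 2) * e + 1)
  split₂ = solve-∀
  regroup : ∀ q d s e → (q + 2 * d + 1) * s + (q + 2 * d + 2) * e + 1 + (q * (s + e) + s) ≡
                        (s + e) * (2 * (suc q + d)) + 1
  regroup = solve-∀

evenRow-evenCol-sum : ∀ {n₁ m v s} → 1 ≤ v → v ≤ n₁ → s ≤ m →
  (n₁ + v ∸ 1) * m + s + ((n₁ ∸ v) * m + (suc m ∸ s)) ≡ m * (2 * n₁) + 1
evenRow-evenCol-sum {v = suc w} {s} _ v≤n₁ s≤m
  with m≤n⇒∃[o]m+o≡n v≤n₁ | m≤n⇒∃[o]m+o≡n s≤m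
... | d , refl | e , refl = begin
  (suc w + d + suc w ∸ 1) * (s + e) + s + ((suc w + d ∸ suc w) * (s + e) + (suc (s + e) ∸ s))
    ≡⟨ cong₂ (λ a b → (w + d + suc w) * (s + e) + s + (a * (s + e) + b))
             (m+n∸m≡n (suc w) d) (m≡n+o⇒m∸n≡o s (sym (+-suc s e))) ⟩
  (w + d + suc w) * (s + e) + s + (d * (s + e) + suc e)
    ≡⟨ regroup w d s e ⟩
  (s + e) * (2 * (suc w + d)) + 1 ∎
  where
  open ≡-Reasoning
  regroup : ∀ w d s e → (w + d + suc w) * (s + e) + s + (d * (s + e) + suc e) ≡
                        (s + e) * (2 * (suc w + d)) + 1
  regroup = solve-∀

n∸m<n⇒0<m : ∀ {m n} → n ∸ m < n → 0 < m
n∸m<n⇒0<m {zero}  n<n = ⊥-elim (<-irrefl refl n<n)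
n∸m<n⇒0<m {suc m} _   = s≤s z≤n

leftLabel-folds : ∀ {m n₁ i j} → i ∈[ 1 , m ] → j ∈[ 1 , n₁ ] →
  Folds (isOddᵇ i) (m * (2 * n₁) + 1) (leftLabel m n₁ i j) (foldedLabel m n₁ i j)
leftLabel-folds {m} {n₁} {i} {j} i∈@(_ , i≤m) j∈@(1≤j , j≤n₁) =
  byParity (rowRank≤m m i∈)
           (IsBijectionOn.maps (colBlock-isBijectionOn n₁) j∈)
  where
  h = (m + 1) / 2
  byParity : rowRank m i ≤ m → colBlock n₁ j < n₁ →
             Folds (isOddᵇ i) (m * (2 * n₁) + 1) (leftLabel m n₁ i j) (foldedLabel m n₁ i j)
  byParity rank≤m block<n₁ with isOddᵇ i | isOddᵇ j
  ... | true  | true  = refl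
  ... | true  | false = [d+1]*m+1∸r≡d*m+[1+m∸r] (n₁ ∸ j / 2) m
                          (≤-trans (m/n≤m (i + 1) 2) (subst (i + 1 ≤_) (+-comm m 1) (+-monoˡ-≤ 1 i≤m)))
  ... | false | true  =
    trans (cong (_+ (((j + 1) / 2 ∸ 1) * m + (h + i / 2)))
                (∸-+-assoc ((2 * n₁ + 1 ∸ (j + 1) / 2) * m + 1) h (i / 2)))
          (evenRow-oddCol-sum (/-monoˡ-≤ 2 (+-monoˡ-≤ 1 1≤j)) block<n₁ rank≤m)
  ... | false | false =
    trans (cong (_+ ((n₁ ∸ j / 2) * m + (suc m ∸ (h + i / 2))))
                (+-assoc ((n₁ + j / 2 ∸ 1) * m) h (i / 2)))
          (evenRow-evenCol-sum (n∸m<n⇒0<m block<n₁) (≤-trans (m/n≤m j 2) j≤n₁) rank≤m)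

module _ {m n₁ : ℕ} where

  private
    T = m * (2 * n₁) + 1
    L = leftLabel m n₁

    adjacentSum : ℕ → ℕ
    adjacentSum j = (colBlock n₁ j + colBlock n₁ (suc j)) * m + suc m

  leftLabel-isComplementTransversal :
    IsComplementTransversal (_∈[ 1 , m ]) (_∈[ 1 , n₁ ]) (m * (2 * n₁)) L
  leftLabel-isComplementTransversal =
    subst (λ M → IsComplementTransversal (_∈[ 1 , m ]) (_∈[ 1 , n₁ ]) M L) (sym M≡N+N)
      (SignedFolding.isComplementTransversal isOddᵇ (foldedLabel-isBijectionOn₂ m n₁)
        (λ {i} {j} i∈ j∈ →
          subst (λ M → Folds (isOddᵇ i) (M + 1) (L i j) (foldedLabel m n₁ i j)) M≡N+N
                (leftLabel-folds i∈ j∈)))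
    where
    M≡N+N : m * (2 * n₁) ≡ n₁ * m + n₁ * m
    M≡N+N = trans (cong (m *_) (2*n≡n+n n₁))
                  (trans (*-distribˡ-+ m n₁ n₁) (cong₂ _+_ (*-comm m n₁) (*-comm m n₁)))

  leftLabel-adjacent : ∀ {i j} → i ∈[ 1 , m ] → 1 ≤ j → suc j ≤ n₁ →
                       Folds (isOddᵇ i) (T + T) (L i j + L i (suc j)) (adjacentSum j)
  leftLabel-adjacent {i} {j} i∈ 1≤j 1+j≤n₁ =
    subst (Folds (isOddᵇ i) (T + T) (L i j + L i (suc j))) (foldedLabel-adjacent j i∈)
      (Folds-+ (isOddᵇ i) (leftLabel-folds i∈ (1≤j , <⇒≤ 1+j≤n₁))
                          (leftLabel-folds i∈ (s≤s z≤n , 1+j≤n₁)))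

  leftLabel-consecutiveRows : Mirror.ConsecutiveRowsMagic m n₁ L leftLabel-isComplementTransversal
  leftLabel-consecutiveRows {i} {j} 1≤i 1+i≤m 1≤j 1+j≤n₁ =
    Folds-opposite (isOddᵇ i) (leftLabel-adjacent (1≤i , <⇒≤ 1+i≤m) 1≤j 1+j≤n₁)
      (subst (λ b → Folds b (T + T) (L (suc i) j + L (suc i) (suc j)) (adjacentSum j)) (isOddᵇ-suc i)
        (leftLabel-adjacent (s≤s z≤n , 1+i≤m) 1≤j 1+j≤n₁))

  leftLabel-twist : isOdd m → 1 ≤ m → Mirror.TwistCompatible m n₁ L leftLabel-isComplementTransversal
  leftLabel-twist m-odd 1≤m {j} 1≤j 1+j≤n₁ =
    trans (subst (λ b → Folds b (T + T) (L m j + L m (suc j)) (adjacentSum j)) (cong (_≡ᵇ 1) m-odd)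
                 (leftLabel-adjacent (1≤m , ≤-refl) 1≤j 1+j≤n₁))
          (sym (leftLabel-adjacent (≤-refl , 1≤m) 1≤j 1+j≤n₁))

proposition3p3 : (m n₁ : ℕ) → 3 ≤ m → isOdd m → 1 ≤ n₁ →
    IsC4FaceMagicKlein m (2 * n₁) (X m n₁)
proposition3p3 m n₁ 3≤m m-odd _ =
  Mirror.isC4FaceMagicKlein m n₁ (leftLabel m n₁) leftLabel-isComplementTransversal
    1≤m leftLabel-consecutiveRows (leftLabel-twist m-odd 1≤m)
  where
  1≤m : 1 ≤ m
  1≤m = ≤-trans (s≤s z≤n) 3≤m
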